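{- Let $G\in\mathcal{C}$ be connected and let $o$ be an extremal orientation of $G$. If $u\ne v$ are two vertices with $d^o_+(u)=d^o_+(v)=2$, then $|N^o_+(u)\cup N^o_+(v)|\le 3$; equivalently, $u$ and $v$ have at least one common out-neighbor.
   Context: All graphs are finite and simple. $\mathcal{C}$ is the class of graphs in which every connected component contains a cycle. An orientation $o$ of $G$ is valid if every vertex has in-degree at least $1$. For a directed graph, a total dominating set is a set $S$ such that every vertex has an in-neighbor in $S$, and $\gamma_t$ is the minimum size of such a set. A valid orientation $o$ of a connected graph $G\in\mathcal{C}$ is extremal if its total domination number equals $|V(G)|-1$. $N^o_+(v)$ and $d^o_+(v)$ are the out-neighborhood and out-degree of $v$ in $o$. -}

module Defs where

open import Data.Nat using (ℕ; zero; suc; _≤_; _∸_)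
open import Data.Bool using (Bool; true; false)
open import Data.Fin using (Fin; zero; suc; inject₁; fromℕ)
open import Data.Fin.Subset using (Subset; _∈_; ∣_∣)
open import Data.Vec using (tabulate)
open import Data.Product using (Σ; ∃; _×_; _,_)
open import Data.Sum using (_⊎_)
open import Function.Definitions using (Injective)
open import Relation.Binary.PropositionalEquality using (_≡_)
open import Relation.Binary.Construct.Closure.ReflexiveTransitive using (Star)

record Graph (n : ℕ) : Set where
  field
    adj   : Fin n → Fin n → Bool
    sym   : ∀ u v → adj u v ≡ adj v u
    irrefl : ∀ v → adj v v ≡ false

module _ {n : ℕ} (G : Graph n) where
  open Graph G

  Adj : Fin n → Fin n → Set
  Adj u v = adj u v ≡ true

  Connected : Set
  Connected = ∀ u v → Star Adj u v

  -- a cycle of length k = m + 3 : distinct vertices c 0, …, c (k-1),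
  -- consecutive ones adjacent and c (k-1) adjacent to c 0
  record Cycle : Set where
    field
      m      : ℕ
      c      : Fin (suc (suc (suc m))) → Fin n
      inj    : Injective _≡_ _≡_ c
      step   : ∀ (i : Fin (suc (suc m))) → Adj (c (inject₁ i)) (c (suc i))
      close  : Adj (c (fromℕ (suc (suc m)))) (c zero)

  HasCycle : Set
  HasCycle = Cycle

  -- an orientation: arc u v means u → v; each edge gets exactly one direction,
  -- and arcs only go along edges
  record Orientation : Set where
    field
      arc      : Fin n → Fin n → Bool
      arc⇒adj  : ∀ u v → arc u v ≡ true → Adj u v
      adj⇒arc  : ∀ u v → Adj u v → (arc u v ≡ true) ⊎ (arc v u ≡ true)
      antisym  : ∀ u v → arc u v ≡ true → arc v u ≡ false

  module _ (o : Orientation) where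
    open Orientation o

    Arc : Fin n → Fin n → Set
    Arc u v = arc u v ≡ true

    Valid : Set
    Valid = ∀ v → ∃ λ u → Arc u v

    outNbhd : Fin n → Subset n
    outNbhd v = tabulate (λ w → arc v w)

    outDeg : Fin n → ℕ
    outDeg v = ∣ outNbhd v ∣

    TotalDominating : Subset n → Set
    TotalDominating S = ∀ v → ∃ λ u → u ∈ S × Arc u v

    TotalDominationNumber≡ : ℕ → Set
    TotalDominationNumber≡ k =
      (Σ (Subset n) λ S → TotalDominating S × ∣ S ∣ ≡ k)
      × (∀ S → TotalDominating S → k ≤ ∣ S ∣)

    Extremal : Set
    Extremal = Valid × TotalDominationNumber≡ (n ∸ 1)

{-# OPTIONS --safe #-}
module Submission where

-- In a valid orientation, any set H of "hubs" that dominates a set D of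
-- vertices can replace D in a total dominating set: add H to a chosen
-- in-neighbour of each vertex outside D. This gives γₜ ≤ ∣H∣ + n − ∣D∣.
-- Taking H = {u, v} and D = N⁺(u) ∪ N⁺(v), extremality (γₜ = n − 1)
-- forces ∣D∣ ≤ 3.

open import Defs
open import Data.Nat using (ℕ; _≤_)
open import Data.Fin using (Fin)
open import Data.Fin.Subset using (∣_∣; _∪_)
open import Data.Product using (_×_)
open import Relation.Binary.PropositionalEquality using (_≡_; _≢_)

open import Data.Nat using (zero; suc; _+_; _∸_; z≤n; s≤s)
open import Data.Nat.Properties
  using (≤-trans; ≤-reflexive; +-suc; +-comm; +-assoc; +-cancelˡ-≤; +-monoˡ-≤; +-monoʳ-≤; m∸n+n≡m; module ≤-Reasoning)
open import Data.Fin using (zero; suc)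
open import Data.Fin.Subset using (Subset; inside; outside; ⊥; ⁅_⁆; ∁; _∈_)
open import Data.Fin.Subset.Properties
  using (∣⊥∣≡0; ∣p∣≤n; ∣p∣≤∣x∷p∣; ∣⁅x⁆∣≡1; ∣∁p∣≡n∸∣p∣; x∈⁅x⁆; x∈p∪q⁺; x∈p∪q⁻; x∉p⇒x∈∁p; _∈?_)
open import Data.Vec using ([]; _∷_; here; there)
open import Data.Vec.Properties using ([]=⇒lookup; lookup∘tabulate)
open import Data.Product using (∃; _,_; proj₁; proj₂)
open import Data.Sum using (inj₁; inj₂)
open import Function using (_∘_)
open import Relation.Nullary using (yes; no)
open import Relation.Binary.PropositionalEquality using (sym; trans; cong)

∣p∪q∣≤∣p∣+∣q∣ : ∀ {n} (p q : Subset n) → ∣ p ∪ q ∣ ≤ ∣ p ∣ + ∣ q ∣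
∣p∪q∣≤∣p∣+∣q∣ []            []            = z≤n
∣p∪q∣≤∣p∣+∣q∣ (inside  ∷ p) (s       ∷ q) =
  s≤s (≤-trans (∣p∪q∣≤∣p∣+∣q∣ p q) (+-monoʳ-≤ ∣ p ∣ (∣p∣≤∣x∷p∣ s q)))
∣p∪q∣≤∣p∣+∣q∣ (outside ∷ p) (inside  ∷ q) =
  ≤-trans (s≤s (∣p∪q∣≤∣p∣+∣q∣ p q)) (≤-reflexive (sym (+-suc ∣ p ∣ ∣ q ∣)))
∣p∪q∣≤∣p∣+∣q∣ (outside ∷ p) (outside ∷ q) = ∣p∪q∣≤∣p∣+∣q∣ p q

∣⁅x⁆∪⁅y⁆∣≤2 : ∀ {n} (x y : Fin n) → ∣ ⁅ x ⁆ ∪ ⁅ y ⁆ ∣ ≤ 2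
∣⁅x⁆∪⁅y⁆∣≤2 x y with ∣p∪q∣≤∣p∣+∣q∣ ⁅ x ⁆ ⁅ y ⁆
... | bound rewrite ∣⁅x⁆∣≡1 x | ∣⁅x⁆∣≡1 y = bound

image : ∀ {m n} → (Fin m → Fin n) → Subset m → Subset n
image f []            = ⊥
image f (inside  ∷ p) = ⁅ f zero ⁆ ∪ image (f ∘ suc) p
image f (outside ∷ p) = image (f ∘ suc) p

∣image∣≤∣p∣ : ∀ {m n} (f : Fin m → Fin n) (p : Subset m) → ∣ image f p ∣ ≤ ∣ p ∣
∣image∣≤∣p∣ {n = n} f [] rewrite ∣⊥∣≡0 n = z≤n
∣image∣≤∣p∣ f (inside ∷ p) with ∣p∪q∣≤∣p∣+∣q∣ ⁅ f zero ⁆ (image (f ∘ suc) p)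
... | bound rewrite ∣⁅x⁆∣≡1 (f zero) = ≤-trans bound (s≤s (∣image∣≤∣p∣ (f ∘ suc) p))
∣image∣≤∣p∣ f (outside ∷ p) = ∣image∣≤∣p∣ (f ∘ suc) p

x∈p⇒f[x]∈image : ∀ {m n} (f : Fin m → Fin n) {p : Subset m} {x} → x ∈ p → f x ∈ image f p
x∈p⇒f[x]∈image f here                     = x∈p∪q⁺ (inj₁ (x∈⁅x⁆ (f zero)))
x∈p⇒f[x]∈image f {inside  ∷ p} (there x∈p) = x∈p∪q⁺ (inj₂ (x∈p⇒f[x]∈image (f ∘ suc) x∈p))
x∈p⇒f[x]∈image f {outside ∷ p} (there x∈p) = x∈p⇒f[x]∈image (f ∘ suc) x∈p

n∸1≤h+[n∸k]⇒k≤1+h : ∀ {n k h} → k ≤ n → n ∸ 1 ≤ h + (n ∸ k) → k ≤ suc h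
n∸1≤h+[n∸k]⇒k≤1+h {zero}  z≤n _ = z≤n
n∸1≤h+[n∸k]⇒k≤1+h {suc n} {k} {h} k≤1+n n≤h+[1+n∸k] = +-cancelˡ-≤ n k (suc h) (begin
  n + k                    ≤⟨ +-monoˡ-≤ k n≤h+[1+n∸k] ⟩
  h + (suc n ∸ k) + k      ≡⟨ +-assoc h (suc n ∸ k) k ⟩
  h + (suc n ∸ k + k)      ≡⟨ cong (h +_) (m∸n+n≡m k≤1+n) ⟩
  h + suc n                ≡⟨ +-suc h n ⟩
  suc (h + n)              ≡⟨ cong suc (+-comm h n) ⟩
  suc (n + h)              ≡⟨ sym (+-suc n h) ⟩
  n + suc h                ∎)
  where open ≤-Reasoning

module _ {n : ℕ} (G : Graph n) (o : Orientation G) where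

  ∈outNbhd⇒Arc : ∀ {u w} → w ∈ outNbhd G o u → Arc G o u w
  ∈outNbhd⇒Arc {u} {w} w∈N⁺u =
    trans (sym (lookup∘tabulate (Orientation.arc o u) w)) ([]=⇒lookup w∈N⁺u)

  Dominates : Subset n → Subset n → Set
  Dominates H D = ∀ {w} → w ∈ D → ∃ λ h → h ∈ H × Arc G o h w

  hubs∪image-totalDominating : (valid : Valid G o) {H D : Subset n} → Dominates H D →
    TotalDominating G o (H ∪ image (proj₁ ∘ valid) (∁ D))
  hubs∪image-totalDominating valid {D = D} H⇉D w with w ∈? D
  ... | yes w∈D = let h , h∈H , h→w = H⇉D w∈D in h , x∈p∪q⁺ (inj₁ h∈H) , h→w
  ... | no  w∉D = proj₁ (valid w)
                , x∈p∪q⁺ (inj₂ (x∈p⇒f[x]∈image (proj₁ ∘ valid) (x∉p⇒x∈∁p w∉D)))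
                , proj₂ (valid w)

  γₜ≤∣H∣+[n∸∣D∣] : ∀ {k} → Valid G o → TotalDominationNumber≡ G o k →
    ∀ {H D} → Dominates H D → k ≤ ∣ H ∣ + (n ∸ ∣ D ∣)
  γₜ≤∣H∣+[n∸∣D∣] valid (_ , minimal) {H} {D} H⇉D = begin
    _                                        ≤⟨ minimal _ (hubs∪image-totalDominating valid H⇉D) ⟩
    ∣ H ∪ image (proj₁ ∘ valid) (∁ D) ∣      ≤⟨ ∣p∪q∣≤∣p∣+∣q∣ H _ ⟩
    ∣ H ∣ + ∣ image (proj₁ ∘ valid) (∁ D) ∣  ≤⟨ +-monoʳ-≤ ∣ H ∣ (∣image∣≤∣p∣ (proj₁ ∘ valid) (∁ D)) ⟩
    ∣ H ∣ + ∣ ∁ D ∣                          ≡⟨ cong (∣ H ∣ +_) (∣∁p∣≡n∸∣p∣ D) ⟩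
    ∣ H ∣ + (n ∸ ∣ D ∣)                      ∎
    where open ≤-Reasoning

  ⁅u⁆∪⁅v⁆-dominates-N⁺u∪N⁺v : ∀ u v → Dominates (⁅ u ⁆ ∪ ⁅ v ⁆) (outNbhd G o u ∪ outNbhd G o v)
  ⁅u⁆∪⁅v⁆-dominates-N⁺u∪N⁺v u v w∈N⁺ with x∈p∪q⁻ (outNbhd G o u) (outNbhd G o v) w∈N⁺
  ... | inj₁ w∈N⁺u = u , x∈p∪q⁺ (inj₁ (x∈⁅x⁆ u)) , ∈outNbhd⇒Arc w∈N⁺u
  ... | inj₂ w∈N⁺v = v , x∈p∪q⁺ (inj₂ (x∈⁅x⁆ v)) , ∈outNbhd⇒Arc w∈N⁺v

  extremal⇒∣N⁺u∪N⁺v∣≤3 : Extremal G o → ∀ u v → ∣ outNbhd G o u ∪ outNbhd G o v ∣ ≤ 3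
  extremal⇒∣N⁺u∪N⁺v∣≤3 (valid , γₜ≡n∸1) u v = n∸1≤h+[n∸k]⇒k≤1+h (∣p∣≤n N⁺) (begin
    n ∸ 1                        ≤⟨ γₜ≤∣H∣+[n∸∣D∣] valid γₜ≡n∸1 (⁅u⁆∪⁅v⁆-dominates-N⁺u∪N⁺v u v) ⟩
    ∣ ⁅ u ⁆ ∪ ⁅ v ⁆ ∣ + (n ∸ ∣ N⁺ ∣) ≤⟨ +-monoˡ-≤ (n ∸ ∣ N⁺ ∣) (∣⁅x⁆∪⁅y⁆∣≤2 u v) ⟩
    2 + (n ∸ ∣ N⁺ ∣)              ∎)
    where
    open ≤-Reasoning
    N⁺ = outNbhd G o u ∪ outNbhd G o v

corollary4 : ∀ {n : ℕ} (G : Graph n) → Connected G → HasCycle G →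
    (o : Orientation G) → Extremal G o →
    (u v : Fin n) → u ≢ v → outDeg G o u ≡ 2 → outDeg G o v ≡ 2 →
    ∣ outNbhd G o u ∪ outNbhd G o v ∣ ≤ 3
corollary4 G _ _ o extremal u v _ _ _ = extremal⇒∣N⁺u∪N⁺v∣≤3 G o extremal u v
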